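{- Let $D$ be the derivation of $\mathbb{Q}[y,z]$ with $D(y)=z^2$, $D(z)=yz$, and define $(Dz)^0(f)=f$, $(Dz)^{n+1}(f)=D\big(z\,(Dz)^n(f)\big)$. Define $M(n,k)$, $N(n,k)$ by $$(Dz)^n(z)=\sum_{k=0}^{\lfloor n/2\rfloor}M(n,k)\,y^{n-2k}z^{n+2k+1},\qquad (Dz)^n(y)=\sum_{k=0}^{\lfloor (n+1)/2\rfloor}N(n,k)\,y^{n-2k+1}z^{n+2k}.$$ Then for $n\ge 0$ and $0\le k\le\lfloor n/2\rfloor$, $$M(n,k)=n!\binom{n+1}{2k+1}\quad\text{and}\quad N(n,k)=n!\binom{n+1}{2k}.$$
   Context: Here $D$ models $d/dx$ with $y=\tan x$, $z=\sec x$; the expansions are taken formally in $\mathbb{Q}[y,z]$ with $y,z$ independent indeterminates, so the coefficients are uniquely determined. -}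

module Defs where

open import Data.Nat as ℕ using (ℕ; zero; suc; _!)
open import Data.Integer using (+_)
open import Relation.Nullary using (yes; no)
open import Data.Rational using (ℚ; 0ℚ; 1ℚ; _+_; _*_; _/_)

ℕ→ℚ : ℕ → ℚ
ℕ→ℚ n = (+ n) / 1

-- A polynomial in ℚ[y,z], represented by its coefficient function:
-- f a b is the coefficient of y^a z^b.  (All polynomials built below are
-- finitely supported; the operations below are the coefficientwise
-- formulas of the corresponding polynomial operations.)
Poly : Set
Poly = ℕ → ℕ → ℚ

mono : ℕ → ℕ → Poly
mono i j a b with i ℕ.≟ a | j ℕ.≟ b
... | yes _ | yes _ = 1ℚ
... | _ | _ = 0ℚ

mulZ : Poly → Poly
mulZ f a zero    = 0ℚ
mulZ f a (suc b) = f a b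

-- The derivation D with D(y) = z^2, D(z) = y z, i.e. on monomials
--   D(y^i z^j) = i y^(i-1) z^(j+2) + j y^(i+1) z^j.
D : Poly → Poly
D f a b = fromY a b + fromZ a b
  where
  fromY : ℕ → ℕ → ℚ
  fromY a (suc (suc b')) = ℕ→ℚ (suc a) * f (suc a) b'
  fromY a _              = 0ℚ
  fromZ : ℕ → ℕ → ℚ
  fromZ (suc a') b = ℕ→ℚ b * f a' b
  fromZ zero     b = 0ℚ

Dz^ : ℕ → Poly → Poly
Dz^ zero    f = f
Dz^ (suc n) f = D (mulZ (Dz^ n f))

M : ℕ → ℕ → ℚ
M n k = Dz^ n (mono 0 1) (n ℕ.∸ 2 ℕ.* k) (n ℕ.+ 2 ℕ.* k ℕ.+ 1)

N : ℕ → ℕ → ℚ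
N n k = Dz^ n (mono 1 0) (n ℕ.∸ 2 ℕ.* k ℕ.+ 1) (n ℕ.+ 2 ℕ.* k)

-- Both (Dz)ⁿ(z) and (Dz)ⁿ(y) are homogeneous of degree 2n+1, and we show that
-- the coefficient of y^a z^(2n+1−a) in (Dz)ⁿ(f), for f = z (p = 0) or f = y
-- (p = 1), is
--     closedForm p n a  =  n! · C(n+1, a)   if a + n + p is even,   0 otherwise.
module Submission where

open import Defs
open import Data.Nat using (ℕ; zero; suc; _+_; _*_; _∸_; _≤_; _<_; _!; s≤s; z≤n)
open import Data.Nat.Properties
  using (+-suc; +-identityʳ; +-monoʳ-<; *-identityˡ; *-identityʳ; *-zeroʳ; *-distribˡ-+; *-distribʳ-+;
         +-cancelˡ-≡; +-comm; *-comm; suc-injective; ≤-refl; ≤-trans; n≤1+n; m≤m+n;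
         <-trans; ≤-<-trans; n<1+n; m+n∸m≡n; m+[n∸m]≡n; m≤n⇒∃[o]m+o≡n)
open import Data.Nat.Combinatorics
  using (_C_; nCk+nC[k+1]≡[n+1]C[k+1]; nCk≡nC[n∸k]; nC1≡n; k>n⇒nCk≡0)
open import Data.Nat.Tactic.RingSolver using (solve-∀)
open import Data.Bool using (Bool; true; false; if_then_else_)
open import Data.Product using (_×_; _,_)
open import Data.Integer as ℤ using (+_)
import Data.Integer.Properties as ℤ
open import Data.Rational as ℚ using (0ℚ; toℚᵘ)
open import Data.Rational.Properties using (toℚᵘ-injective; toℚᵘ-fromℚᵘ; toℚᵘ-homo-+; toℚᵘ-homo-*)
open import Data.Rational.Unnormalised as ℚᵘ using (ℚᵘ; mkℚᵘ; _≃_; *≡*)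
import Data.Rational.Unnormalised.Properties as ℚᵘ
open import Relation.Binary.PropositionalEquality
  using (_≡_; refl; sym; trans; cong; cong₂; subst; subst₂; module ≡-Reasoning)

private
  ℕ→ℚᵘ : ℕ → ℚᵘ
  ℕ→ℚᵘ n = mkℚᵘ (+ n) 0

  toℚᵘ-ℕ→ℚ : ∀ n → toℚᵘ (ℕ→ℚ n) ≃ ℕ→ℚᵘ n
  toℚᵘ-ℕ→ℚ n = toℚᵘ-fromℚᵘ (ℕ→ℚᵘ n)

ℕ→ℚ-+ : ∀ m n → ℕ→ℚ (m + n) ≡ ℕ→ℚ m ℚ.+ ℕ→ℚ n
ℕ→ℚ-+ m n = toℚᵘ-injective (ℚᵘ.≃-sym (begin
    toℚᵘ (ℕ→ℚ m ℚ.+ ℕ→ℚ n)              ≈⟨ toℚᵘ-homo-+ (ℕ→ℚ m) (ℕ→ℚ n) ⟩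
    toℚᵘ (ℕ→ℚ m) ℚᵘ.+ toℚᵘ (ℕ→ℚ n)      ≈⟨ ℚᵘ.+-cong (toℚᵘ-ℕ→ℚ m) (toℚᵘ-ℕ→ℚ n) ⟩
    ℕ→ℚᵘ m ℚᵘ.+ ℕ→ℚᵘ n                  ≈⟨ *≡* (cong (ℤ._* (+ 1)) (cong₂ ℤ._+_ (ℤ.*-identityʳ (+ m)) (ℤ.*-identityʳ (+ n)))) ⟩
    ℕ→ℚᵘ (m + n)                        ≈⟨ ℚᵘ.≃-sym (toℚᵘ-ℕ→ℚ (m + n)) ⟩
    toℚᵘ (ℕ→ℚ (m + n))                  ∎))
  where open ℚᵘ.≃-Reasoning

ℕ→ℚ-* : ∀ m n → ℕ→ℚ (m * n) ≡ ℕ→ℚ m ℚ.* ℕ→ℚ n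
ℕ→ℚ-* m n = toℚᵘ-injective (ℚᵘ.≃-sym (begin
    toℚᵘ (ℕ→ℚ m ℚ.* ℕ→ℚ n)              ≈⟨ toℚᵘ-homo-* (ℕ→ℚ m) (ℕ→ℚ n) ⟩
    toℚᵘ (ℕ→ℚ m) ℚᵘ.* toℚᵘ (ℕ→ℚ n)      ≈⟨ ℚᵘ.*-cong (toℚᵘ-ℕ→ℚ m) (toℚᵘ-ℕ→ℚ n) ⟩
    ℕ→ℚᵘ m ℚᵘ.* ℕ→ℚᵘ n                  ≈⟨ *≡* (cong (ℤ._* (+ 1)) (sym (ℤ.pos-* m n))) ⟩
    ℕ→ℚᵘ (m * n)                        ≈⟨ ℚᵘ.≃-sym (toℚᵘ-ℕ→ℚ (m * n)) ⟩
    toℚᵘ (ℕ→ℚ (m * n))                  ∎))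
  where open ℚᵘ.≃-Reasoning

absorption : ∀ m k → suc k * (suc m C suc k) ≡ suc m * (m C k)
absorption m       zero    = trans (*-identityˡ (suc m C 1)) (trans (nC1≡n (suc m)) (sym (*-identityʳ (suc m))))
-- Here both C(1,k+2) and C(0,k+1) compute to 0.
absorption zero    (suc k) = *-zeroʳ (suc (suc k))
absorption (suc m) (suc k) = begin
    suc (suc k) * (suc (suc m) C suc (suc k))
      ≡⟨ cong (suc (suc k) *_) (nCk+nC[k+1]≡[n+1]C[k+1] (suc m) (suc k)) ⟨
    suc (suc k) * (P + Q)
      ≡⟨ regroup₁ k P Q ⟩
    suc k * P + P + suc (suc k) * Q
      ≡⟨ cong₂ (λ x y → x + P + y) (absorption m k) (absorption m (suc k)) ⟩
    suc m * (m C k) + P + suc m * (m C suc k)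
      ≡⟨ regroup₂ m (m C k) P (m C suc k) ⟩
    suc m * (m C k + m C suc k) + P
      ≡⟨ cong (λ x → suc m * x + P) (nCk+nC[k+1]≡[n+1]C[k+1] m k) ⟩
    suc m * P + P
      ≡⟨ regroup₃ m P ⟩
    suc (suc m) * P
      ∎
  where
  open ≡-Reasoning
  P = suc m C suc k
  Q = suc m C suc (suc k)
  regroup₁ : ∀ k P Q → suc (suc k) * (P + Q) ≡ suc k * P + P + suc (suc k) * Q
  regroup₁ = solve-∀
  regroup₂ : ∀ m x P y → suc m * x + P + suc m * y ≡ suc m * (x + y) + P
  regroup₂ = solve-∀
  regroup₃ : ∀ m P → suc m * P + P ≡ suc (suc m) * P
  regroup₃ = solve-∀

-- Complementary absorption, (n+1−a)·C(n+1,a) = (n+1)·C(n,a), in subtraction-free form.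
absorption-complement : ∀ n a → a * (suc n C a) + suc n * (n C a) ≡ suc n * (suc n C a)
absorption-complement n zero    = refl
absorption-complement n (suc a) = begin
    suc a * (suc n C suc a) + suc n * (n C suc a)   ≡⟨ cong (_+ suc n * (n C suc a)) (absorption n a) ⟩
    suc n * (n C a) + suc n * (n C suc a)           ≡⟨ *-distribˡ-+ (suc n) (n C a) (n C suc a) ⟨
    suc n * (n C a + n C suc a)                     ≡⟨ cong (suc n *_) (nCk+nC[k+1]≡[n+1]C[k+1] n a) ⟩
    suc n * (suc n C suc a)                         ∎
  where open ≡-Reasoning

complement-weight : ∀ n a c → a + c ≡ suc n + suc n →
  c * (suc n C a) ≡ suc n * (suc n C a) + suc n * (n C a)
complement-weight n a c a+c≡2[n+1] = +-cancelˡ-≡ (a * X) _ _ (begin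
    a * X + c * X                       ≡⟨ *-distribʳ-+ X a c ⟨
    (a + c) * X                         ≡⟨ cong (_* X) a+c≡2[n+1] ⟩
    (suc n + suc n) * X                 ≡⟨ *-distribʳ-+ X (suc n) (suc n) ⟩
    suc n * X + suc n * X               ≡⟨ cong (_+ suc n * X) (absorption-complement n a) ⟨
    a * X + suc n * Y + suc n * X       ≡⟨ regroup (a * X) (suc n * Y) (suc n * X) ⟩
    a * X + (suc n * X + suc n * Y)     ∎)
  where
  open ≡-Reasoning
  X = suc n C a
  Y = n C a
  regroup : ∀ p q r → p + q + r ≡ p + (r + q)
  regroup = solve-∀

-- The binomial recurrence behind the action of D ∘ z:
-- (a+2)·C(n+1,a+2) + (2n+2−a)·C(n+1,a) = (n+1)·C(n+2,a+1).
binomial-recurrence : ∀ n a c → a + c ≡ suc n + suc n →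
  suc (suc a) * (suc n C suc (suc a)) + c * (suc n C a) ≡ suc n * (suc (suc n) C suc a)
binomial-recurrence n a c a+c≡2[n+1] = begin
    suc (suc a) * (suc n C suc (suc a)) + c * (suc n C a)
      ≡⟨ cong₂ _+_ (absorption n (suc a)) (complement-weight n a c a+c≡2[n+1]) ⟩
    suc n * (n C suc a) + (suc n * (suc n C a) + suc n * (n C a))
      ≡⟨ factor (suc n) (n C suc a) (suc n C a) (n C a) ⟩
    suc n * (suc n C a + (n C a + n C suc a))
      ≡⟨ cong (λ x → suc n * (suc n C a + x)) (nCk+nC[k+1]≡[n+1]C[k+1] n a) ⟩
    suc n * (suc n C a + suc n C suc a)
      ≡⟨ cong (suc n *_) (nCk+nC[k+1]≡[n+1]C[k+1] (suc n) a) ⟩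
    suc n * (suc (suc n) C suc a)
      ∎
  where
  open ≡-Reasoning
  factor : ∀ s z x y → s * z + (s * x + s * y) ≡ s * (x + (y + z))
  factor = solve-∀

HomogeneousPart : Poly → ℕ → (ℕ → ℕ) → Set
HomogeneousPart f m c = ∀ a b → a + b ≡ m → f a b ≡ ℕ→ℚ (c a)

VanishesAbove : ℕ → (ℕ → ℕ) → Set
VanishesAbove m c = ∀ a → m < a → c a ≡ 0

HomogeneousPart-cong : ∀ {f m c c′} → (∀ a → a ≤ m → c a ≡ c′ a) →
  HomogeneousPart f m c → HomogeneousPart f m c′
HomogeneousPart-cong c≗c′ part a b a+b≡m =
  trans (part a b a+b≡m) (cong ℕ→ℚ (c≗c′ a (subst (a ≤_) a+b≡m (m≤m+n a b))))

-- Multiplying by z raises the degree and keeps the coefficient sequence; the one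
-- new monomial y^(m+1) has coefficient c(m+1) = 0.
mulZ-homogeneousPart : ∀ {g m c} → HomogeneousPart g m c → VanishesAbove m c →
  HomogeneousPart (mulZ g) (suc m) c
mulZ-homogeneousPart {m = m} part vanish a zero    a+0≡1+m =
  sym (cong ℕ→ℚ (vanish a (subst (m <_) (trans (sym a+0≡1+m) (+-identityʳ a)) (n<1+n m))))
mulZ-homogeneousPart         part vanish a (suc b) a+1+b≡1+m =
  part a b (suc-injective (trans (sym (+-suc a b)) a+1+b≡1+m))

-- As D(y^i z^j) = i·y^(i−1) z^(j+2) + j·y^(i+1) z^j, the monomial y^a z^(m+1−a)
-- receives (a+1)·c(a+1) from y^(a+1) z^(m−a−1) and, if a ≥ 1, (m+1−a)·c(a−1)
-- from y^(a−1) z^(m+1−a).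
DCoeffs : ℕ → (ℕ → ℕ) → ℕ → ℕ
DCoeffs m c zero    = 1 * c 1 + 0
DCoeffs m c (suc a) = suc (suc a) * c (suc (suc a)) + (m ∸ a) * c a

-- D acts on degree-m components through DCoeffs; the vanishing hypothesis
-- accounts for the monomials with z-exponent < 2, which no y-derivative reaches.
D-homogeneousPart : ∀ {h m c} → HomogeneousPart h m c → VanishesAbove m c →
  HomogeneousPart (D h) (suc m) (DCoeffs m c)
D-homogeneousPart {h} {m} {c} part vanish = coeff
  where
  combine : ∀ a b x → a + b ≡ m → x ≡ ℕ→ℚ (suc (suc a) * c (suc (suc a))) →
    x ℚ.+ ℕ→ℚ b ℚ.* h a b ≡ ℕ→ℚ (DCoeffs m c (suc a))
  combine a b x a+b≡m x≡Y = begin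
      x ℚ.+ ℕ→ℚ b ℚ.* h a b
        ≡⟨ cong₂ ℚ._+_ x≡Y (cong (ℕ→ℚ b ℚ.*_) (part a b a+b≡m)) ⟩
      ℕ→ℚ Y ℚ.+ ℕ→ℚ b ℚ.* ℕ→ℚ (c a)
        ≡⟨ cong (ℕ→ℚ Y ℚ.+_) (ℕ→ℚ-* b (c a)) ⟨
      ℕ→ℚ Y ℚ.+ ℕ→ℚ (b * c a)
        ≡⟨ ℕ→ℚ-+ Y (b * c a) ⟨
      ℕ→ℚ (Y + b * c a)
        ≡⟨ cong (λ j → ℕ→ℚ (Y + j * c a)) (trans (sym (m+n∸m≡n a b)) (cong (_∸ a) a+b≡m)) ⟩
      ℕ→ℚ (DCoeffs m c (suc a))
        ∎
    where
    open ≡-Reasoning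
    Y = suc (suc a) * c (suc (suc a))

  noYTerm : ∀ a b → a + b ≡ m → b < 2 → 0ℚ ≡ ℕ→ℚ (suc (suc a) * c (suc (suc a)))
  noYTerm a b a+b≡m b<2 = cong ℕ→ℚ (sym (trans (cong (suc (suc a) *_) (vanish _ m<a+2)) (*-zeroʳ (suc (suc a)))))
    where
    m<a+2 : m < suc (suc a)
    m<a+2 = subst₂ _<_ a+b≡m (+-comm a 2) (+-monoʳ-< a b<2)

  coeff : HomogeneousPart (D h) (suc m) (DCoeffs m c)
  coeff zero          zero          ()
  -- D h 0 1 is 0 + 0, and c(1) = 0 as m = 0.
  coeff zero          (suc zero)    refl =
    cong ℕ→ℚ (sym (cong (λ x → 1 * x + 0) (vanish 1 ≤-refl)))
  coeff zero          (suc (suc b)) 2+b≡1+m =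
    trans (cong (λ x → ℕ→ℚ 1 ℚ.* x ℚ.+ 0ℚ) (part 1 b (suc-injective 2+b≡1+m)))
          (sym (trans (ℕ→ℚ-+ (1 * c 1) 0) (cong (ℚ._+ 0ℚ) (ℕ→ℚ-* 1 (c 1)))))
  coeff (suc a)       zero          a+0≡m =
    combine a 0 0ℚ (suc-injective a+0≡m) (noYTerm a 0 (suc-injective a+0≡m) (s≤s z≤n))
  coeff (suc a)       (suc zero)    a+1≡m =
    combine a 1 0ℚ (suc-injective a+1≡m) (noYTerm a 1 (suc-injective a+1≡m) ≤-refl)
  coeff (suc a)       (suc (suc b)) a+2+b≡m =
    combine a (suc (suc b)) _ (suc-injective a+2+b≡m)
      (trans (cong (ℕ→ℚ (suc (suc a)) ℚ.*_) (part (suc (suc a)) b 2+a+b≡m))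
             (sym (ℕ→ℚ-* (suc (suc a)) (c (suc (suc a))))))
    where
    2+a+b≡m : suc (suc a) + b ≡ m
    2+a+b≡m = trans (sym (trans (+-suc a (suc b)) (cong suc (+-suc a b)))) (suc-injective a+2+b≡m)

Dz-homogeneousPart : ∀ {g m c} → HomogeneousPart g m c → VanishesAbove m c →
  HomogeneousPart (D (mulZ g)) (suc (suc m)) (DCoeffs (suc m) c)
Dz-homogeneousPart {m = m} part vanish =
  D-homogeneousPart (mulZ-homogeneousPart part vanish) (λ a 1+m<a → vanish a (<-trans (n<1+n m) 1+m<a))

-- Parity selects which monomials occur: (Dz)ⁿ(z) only has y^a with a ≡ n (mod 2).
isEven : ℕ → Bool
isEven zero          = true
isEven (suc zero)    = false
isEven (suc (suc n)) = isEven n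

isEven-double : ∀ m → isEven (m + m) ≡ true
isEven-double zero    = refl
isEven-double (suc m) = trans (cong isEven (cong suc (+-suc m m))) (isEven-double m)

closedForm : ℕ → ℕ → ℕ → ℕ
closedForm p n a = if isEven (a + n + p) then n ! * (suc n C a) else 0

closedForm-even : ∀ p n a → isEven (a + n + p) ≡ true → closedForm p n a ≡ n ! * (suc n C a)
closedForm-even p n a even rewrite even = refl

closedForm-vanishes : ∀ p n a → suc n < a → closedForm p n a ≡ 0
closedForm-vanishes p n a 1+n<a with isEven (a + n + p)
... | true  = trans (cong (n ! *_) (k>n⇒nCk≡0 1+n<a)) (*-zeroʳ (n !))
... | false = refl

-- The recurrence for a ≥ 1: the parities of a+2, a (at level n) and a+1 (at
-- level n+1) agree, and the nonzero case is the binomial recurrence times n!.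
closedForm-recurrence : ∀ p n a c → a + c ≡ suc n + suc n →
  suc (suc a) * closedForm p n (suc (suc a)) + c * closedForm p n a ≡ closedForm p (suc n) (suc a)
closedForm-recurrence p n a c a+c≡2[n+1] rewrite +-suc a n with isEven (a + n + p)
... | true  = begin
    suc (suc a) * (n ! * B₂) + c * (n ! * B₀)   ≡⟨ factor (suc (suc a)) (n !) B₂ c B₀ ⟩
    n ! * (suc (suc a) * B₂ + c * B₀)           ≡⟨ cong (n ! *_) (binomial-recurrence n a c a+c≡2[n+1]) ⟩
    n ! * (suc n * (suc (suc n) C suc a))       ≡⟨ reassociate (suc n) (n !) (suc (suc n) C suc a) ⟩
    suc n ! * (suc (suc n) C suc a)             ∎
  where
  open ≡-Reasoning
  B₂ = suc n C suc (suc a)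
  B₀ = suc n C a
  factor : ∀ s f x c y → s * (f * x) + c * (f * y) ≡ f * (s * x + c * y)
  factor = solve-∀
  reassociate : ∀ s f x → f * (s * x) ≡ s * f * x
  reassociate = solve-∀
... | false = cong₂ _+_ (*-zeroʳ (suc (suc a))) (*-zeroʳ c)

closedForm-step : ∀ p n a → a ≤ suc (suc (suc (n + n))) →
  DCoeffs (suc (suc (n + n))) (closedForm p n) a ≡ closedForm p (suc n) a
closedForm-step p n zero    _ = begin
    1 * closedForm p n 1 + 0   ≡⟨ trans (+-identityʳ _) (*-identityˡ _) ⟩
    closedForm p n 1           ≡⟨ lowest ⟩
    closedForm p (suc n) 0     ∎
  where
  open ≡-Reasoning
  -- C(n+1,1) = n+1, so n!·C(n+1,1) = (n+1)!·C(n+2,0).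
  lowest : closedForm p n 1 ≡ closedForm p (suc n) 0
  lowest with isEven (suc (n + p))
  ... | true  = trans (cong (n ! *_) (nC1≡n (suc n))) (trans (*-comm (n !) (suc n)) (sym (*-identityʳ (suc n !))))
  ... | false = refl
closedForm-step p n (suc a) (s≤s a≤2n+2) =
  closedForm-recurrence p n a (suc (suc (n + n)) ∸ a)
    (trans (m+[n∸m]≡n a≤2n+2) (cong suc (sym (+-suc n n))))

Dz^-homogeneousPart : ∀ p f → HomogeneousPart f 1 (closedForm p 0) →
  ∀ n → HomogeneousPart (Dz^ n f) (suc (n + n)) (closedForm p n)
Dz^-homogeneousPart p f base zero    = base
Dz^-homogeneousPart p f base (suc n) =
  subst (λ d → HomogeneousPart (Dz^ (suc n) f) d (closedForm p (suc n)))
        (cong (λ m → suc (suc m)) (sym (+-suc n n)))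
        (HomogeneousPart-cong (closedForm-step p n)
          (Dz-homogeneousPart (Dz^-homogeneousPart p f base n) vanish))
  where
  vanish : VanishesAbove (suc (n + n)) (closedForm p n)
  vanish a 2n+1<a = closedForm-vanishes p n a (≤-<-trans (s≤s (m≤m+n n n)) 2n+1<a)

z-base : HomogeneousPart (mono 0 1) 1 (closedForm 0 0)
z-base zero       (suc zero) refl = refl
z-base (suc zero) zero       refl = refl

y-base : HomogeneousPart (mono 1 0) 1 (closedForm 1 0)
y-base zero       (suc zero) refl = refl
y-base (suc zero) zero       refl = refl

Dz^-coefficient : ∀ p f → HomogeneousPart f 1 (closedForm p 0) →
  ∀ n a b → a + b ≡ suc (n + n) → isEven (a + n + p) ≡ true →
  Dz^ n f a b ≡ ℕ→ℚ (n ! * (suc n C a))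
Dz^-coefficient p f base n a b a+b≡2n+1 even =
  trans (Dz^-homogeneousPart p f base n a b a+b≡2n+1) (cong ℕ→ℚ (closedForm-even p n a even))

M-value : ∀ k r →
  M (2 * k + r) k ≡ ℕ→ℚ ((2 * k + r) ! * ((2 * k + r + 1) C (2 * k + 1)))
M-value k r = begin
    M n k
      ≡⟨ cong (λ a → Dz^ n (mono 0 1) a (n + K + 1)) (m+n∸m≡n K r) ⟩
    Dz^ n (mono 0 1) r (n + K + 1)
      ≡⟨ Dz^-coefficient 0 (mono 0 1) z-base n r (n + K + 1) (degree K r) parity ⟩
    ℕ→ℚ (n ! * (suc n C r))
      ≡⟨ cong (λ x → ℕ→ℚ (n ! * x)) symmetry ⟨
    ℕ→ℚ (n ! * ((n + 1) C (K + 1)))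
      ∎
  where
  open ≡-Reasoning
  K = 2 * k
  n = K + r
  degree : ∀ K r → r + (K + r + K + 1) ≡ suc (K + r + (K + r))
  degree = solve-∀
  halves : ∀ k r → r + (2 * k + r) + 0 ≡ (k + r) + (k + r)
  halves = solve-∀
  parity : isEven (r + n + 0) ≡ true
  parity = trans (cong isEven (halves k r)) (isEven-double (k + r))
  symmetry : (n + 1) C (K + 1) ≡ suc n C r
  symmetry = begin
    (n + 1) C (K + 1)     ≡⟨ cong₂ _C_ (+-comm n 1) (+-comm K 1) ⟩
    suc n C suc K         ≡⟨ nCk≡nC[n∸k] (s≤s (m≤m+n K r)) ⟩
    suc n C (n ∸ K)       ≡⟨ cong (suc n C_) (m+n∸m≡n K r) ⟩
    suc n C r             ∎

N-value : ∀ k r →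
  N (2 * k + r) k ≡ ℕ→ℚ ((2 * k + r) ! * ((2 * k + r + 1) C (2 * k)))
N-value k r = begin
    N n k
      ≡⟨ cong (λ a → Dz^ n (mono 1 0) (a + 1) (n + K)) (m+n∸m≡n K r) ⟩
    Dz^ n (mono 1 0) (r + 1) (n + K)
      ≡⟨ Dz^-coefficient 1 (mono 1 0) y-base n (r + 1) (n + K) (degree K r) parity ⟩
    ℕ→ℚ (n ! * (suc n C (r + 1)))
      ≡⟨ cong (λ x → ℕ→ℚ (n ! * x)) symmetry ⟨
    ℕ→ℚ (n ! * ((n + 1) C K))
      ∎
  where
  open ≡-Reasoning
  K = 2 * k
  n = K + r
  degree : ∀ K r → r + 1 + (K + r + K) ≡ suc (K + r + (K + r))
  degree = solve-∀
  halves : ∀ k r → r + 1 + (2 * k + r) + 1 ≡ suc (k + r) + suc (k + r)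
  halves = solve-∀
  parity : isEven (r + 1 + n + 1) ≡ true
  parity = trans (cong isEven (halves k r)) (isEven-double (suc (k + r)))
  symmetry : (n + 1) C K ≡ suc n C (r + 1)
  symmetry = begin
    (n + 1) C K           ≡⟨ cong (_C K) (+-comm n 1) ⟩
    suc n C K             ≡⟨ nCk≡nC[n∸k] (≤-trans (m≤m+n K r) (n≤1+n n)) ⟩
    suc n C (suc n ∸ K)   ≡⟨ cong (λ x → suc n C (x ∸ K)) (sym (+-suc K r)) ⟩
    suc n C (K + suc r ∸ K) ≡⟨ cong (suc n C_) (trans (m+n∸m≡n K (suc r)) (+-comm 1 r)) ⟩
    suc n C (r + 1)       ∎

corollary1 : (n k : ℕ) → 2 * k ≤ n →
    (M n k ≡ ℕ→ℚ (n ! * ((n + 1) C (2 * k + 1))))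
      × (N n k ≡ ℕ→ℚ (n ! * ((n + 1) C (2 * k))))
corollary1 n k 2k≤n with m≤n⇒∃[o]m+o≡n 2k≤n
... | r , refl = M-value k r , N-value k r
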